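{- For every set of formulas $\Gamma$ and all formulas $\varphi,\psi$ of Nelson's logic $\mathcal S$: $\Gamma\cup\{\varphi\}\vdash_{\mathcal S}\psi$ if and only if $\Gamma\vdash_{\mathcal S}\varphi^2\Rightarrow\psi$, where $\varphi^2:=\neg(\varphi\Rightarrow\neg\varphi)$.
   Context: Nelson's logic $\mathcal S$ is the sentential logic in the language $\langle\land,\lor,\Rightarrow,\neg,0\rangle$ (types $2,2,2,1,0$) given by the following Hilbert-style calculus. Abbreviations: $\phi\Leftrightarrow\psi:=(\phi\Rightarrow\psi)\land(\psi\Rightarrow\phi)$, $1:=\neg 0$, $\phi\Rightarrow^2\psi:=\phi\Rightarrow(\phi\Rightarrow\psi)$; for a finite (possibly empty) list $\Gamma=(\phi_1,\dots,\phi_n)$ of formulas, $\Gamma\Rightarrow\phi:=\phi_1\Rightarrow(\phi_2\Rightarrow(\cdots(\phi_n\Rightarrow\phi)\cdots))$ and $\Gamma\Rightarrow^2\phi:=\phi_1\Rightarrow^2(\phi_2\Rightarrow^2(\cdots(\phi_n\Rightarrow^2\phi)\cdots))$, both being $\phi$ if $\Gamma$ is empty. Axiom schemata: (A1) $\phi\Rightarrow\phi$; (A2) $0\Rightarrow\psi$; (A3) $\neg\phi\Rightarrow(\phi\Rightarrow0)$; (A4) $1$; (A5) $(\phi\Rightarrow\psi)\Leftrightarrow(\neg\psi\Rightarrow\neg\phi)$. Rule schemata (for all formulas and every finite list $\Gamma$), written "premisses / conclusion": (P) $\Gamma\Rightarrow(\phi\Rightarrow(\psi\Rightarrow\gamma))$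 / $\Gamma\Rightarrow(\psi\Rightarrow(\phi\Rightarrow\gamma))$; (C) $\phi\Rightarrow(\phi\Rightarrow(\phi\Rightarrow\gamma))$ / $\phi\Rightarrow(\phi\Rightarrow\gamma)$; (E) $\Gamma\Rightarrow\phi$, $\phi\Rightarrow\gamma$ / $\Gamma\Rightarrow\gamma$; ($\Rightarrow$l) $\Gamma\Rightarrow\phi$, $\psi\Rightarrow\gamma$ / $\Gamma\Rightarrow((\phi\Rightarrow\psi)\Rightarrow\gamma)$; ($\Rightarrow$r) $\gamma$ / $\phi\Rightarrow\gamma$; ($\land$l1) $\phi\Rightarrow\gamma$ / $(\phi\land\psi)\Rightarrow\gamma$; ($\land$l2) $\psi\Rightarrow\gamma$ / $(\phi\land\psi)\Rightarrow\gamma$; ($\land$r) $\Gamma\Rightarrow\phi$, $\Gamma\Rightarrow\psi$ / $\Gamma\Rightarrow(\phi\land\psi)$; ($\lor$l1) $\phi\Rightarrow\gamma$, $\psi\Rightarrow\gamma$ / $(\phi\lor\psi)\Rightarrow\gamma$; ($\lor$l2) $\phi\Rightarrow^2\gamma$, $\psi\Rightarrow^2\gamma$ / $(\phi\lor\psi)\Rightarrow^2\gamma$; ($\lor$r1) $\Gamma\Rightarrow\phi$ / $\Gamma\Rightarrow(\phi\lor\psi)$; ($\lor$r2) $\Gamma\Rightarrow\psi$ / $\Gamma\Rightarrow(\phi\lor\psi)$; ($\neg\Rightarrow$l) $(\phi\land\neg\psi)\Rightarrow\gamma$ / $\neg(\phi\Rightarrow\psi)\Rightarrow\gamma$; ($\neg\Rightarrow$r)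 $\Gamma\Rightarrow^2(\phi\land\neg\psi)$ / $\Gamma\Rightarrow^2\neg(\phi\Rightarrow\psi)$; ($\neg\land$l) $(\neg\phi\lor\neg\psi)\Rightarrow\gamma$ / $\neg(\phi\land\psi)\Rightarrow\gamma$; ($\neg\land$r) $\Gamma\Rightarrow(\neg\phi\lor\neg\psi)$ / $\Gamma\Rightarrow\neg(\phi\land\psi)$; ($\neg\lor$l) $(\neg\phi\land\neg\psi)\Rightarrow\gamma$ / $\neg(\phi\lor\psi)\Rightarrow\gamma$; ($\neg\lor$r) $\Gamma\Rightarrow(\neg\phi\land\neg\psi)$ / $\Gamma\Rightarrow\neg(\phi\lor\psi)$; ($\neg\neg$l) $\phi\Rightarrow\gamma$ / $\neg\neg\phi\Rightarrow\gamma$; ($\neg\neg$r) $\Gamma\Rightarrow\phi$ / $\Gamma\Rightarrow\neg\neg\phi$. The consequence relation $\vdash_{\mathcal S}$ is derivability from a set of premisses by finite derivations in this calculus. -}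

module Defs where

open import Data.Nat using (ℕ)
open import Data.List using (List; []; _∷_)
open import Data.Sum using (_⊎_)
open import Relation.Binary.PropositionalEquality using (_≡_)

infixr 5 _⇒_
infixr 6 _∨_
infixr 7 _∧_
infix 8 ¬_
infixr 5 _⇒²_
infix 4 _⇔f_
infixr 4 _⇛_ _⇛²_
infix 9 _²
infixl 3 _,,_
data Form : Set where
  var : ℕ → Form
  _∧_ : Form → Form → Form
  _∨_ : Form → Form → Form
  _⇒_ : Form → Form → Form
  ¬_  : Form → Form
  𝟘   : Form

_⇔f_ : Form → Form → Form
φ ⇔f ψ = (φ ⇒ ψ) ∧ (ψ ⇒ φ)

𝟙 : Form
𝟙 = ¬ 𝟘

_⇒²_ : Form → Form → Form
φ ⇒² ψ = φ ⇒ (φ ⇒ ψ)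

_⇛_ : List Form → Form → Form
[] ⇛ φ = φ
(γ ∷ Γ) ⇛ φ = γ ⇒ (Γ ⇛ φ)

_⇛²_ : List Form → Form → Form
[] ⇛² φ = φ
(γ ∷ Γ) ⇛² φ = γ ⇒² (Γ ⇛² φ)

_² : Form → Form
φ ² = ¬ (φ ⇒ ¬ φ)

Pred : Set₁
Pred = Form → Set

_,,_ : Pred → Form → Pred
(Γ ,, φ) χ = Γ χ ⊎ χ ≡ φ

infix 2 _⊢_
data _⊢_ (H : Pred) : Form → Set where
  hyp  : ∀ {φ} → H φ → H ⊢ φ
  A1   : ∀ {φ} → H ⊢ φ ⇒ φ
  A2   : ∀ {ψ} → H ⊢ 𝟘 ⇒ ψ
  A3   : ∀ {φ} → H ⊢ ¬ φ ⇒ (φ ⇒ 𝟘)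
  A4   : H ⊢ 𝟙
  A5   : ∀ {φ ψ} → H ⊢ (φ ⇒ ψ) ⇔f (¬ ψ ⇒ ¬ φ)
  P    : ∀ Γ {φ ψ γ} → H ⊢ Γ ⇛ (φ ⇒ (ψ ⇒ γ)) → H ⊢ Γ ⇛ (ψ ⇒ (φ ⇒ γ))
  C    : ∀ {φ γ} → H ⊢ φ ⇒ (φ ⇒ (φ ⇒ γ)) → H ⊢ φ ⇒ (φ ⇒ γ)
  E    : ∀ Γ {φ γ} → H ⊢ Γ ⇛ φ → H ⊢ φ ⇒ γ → H ⊢ Γ ⇛ γ
  ⇒l   : ∀ Γ {φ ψ γ} → H ⊢ Γ ⇛ φ → H ⊢ ψ ⇒ γ → H ⊢ Γ ⇛ ((φ ⇒ ψ) ⇒ γ)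
  ⇒r   : ∀ {φ γ} → H ⊢ γ → H ⊢ φ ⇒ γ
  ∧l1  : ∀ {φ ψ γ} → H ⊢ φ ⇒ γ → H ⊢ (φ ∧ ψ) ⇒ γ
  ∧l2  : ∀ {φ ψ γ} → H ⊢ ψ ⇒ γ → H ⊢ (φ ∧ ψ) ⇒ γ
  ∧r   : ∀ Γ {φ ψ} → H ⊢ Γ ⇛ φ → H ⊢ Γ ⇛ ψ → H ⊢ Γ ⇛ (φ ∧ ψ)
  ∨l1  : ∀ {φ ψ γ} → H ⊢ φ ⇒ γ → H ⊢ ψ ⇒ γ → H ⊢ (φ ∨ ψ) ⇒ γ
  ∨l2  : ∀ {φ ψ γ} → H ⊢ φ ⇒² γ → H ⊢ ψ ⇒² γ → H ⊢ (φ ∨ ψ) ⇒² γ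
  ∨r1  : ∀ Γ {φ ψ} → H ⊢ Γ ⇛ φ → H ⊢ Γ ⇛ (φ ∨ ψ)
  ∨r2  : ∀ Γ {φ ψ} → H ⊢ Γ ⇛ ψ → H ⊢ Γ ⇛ (φ ∨ ψ)
  ¬⇒l  : ∀ {φ ψ γ} → H ⊢ (φ ∧ ¬ ψ) ⇒ γ → H ⊢ ¬ (φ ⇒ ψ) ⇒ γ
  ¬⇒r  : ∀ Γ {φ ψ} → H ⊢ Γ ⇛² (φ ∧ ¬ ψ) → H ⊢ Γ ⇛² ¬ (φ ⇒ ψ)
  ¬∧l  : ∀ {φ ψ γ} → H ⊢ (¬ φ ∨ ¬ ψ) ⇒ γ → H ⊢ ¬ (φ ∧ ψ) ⇒ γ
  ¬∧r  : ∀ Γ {φ ψ} → H ⊢ Γ ⇛ (¬ φ ∨ ¬ ψ) → H ⊢ Γ ⇛ ¬ (φ ∧ ψ)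
  ¬∨l  : ∀ {φ ψ γ} → H ⊢ (¬ φ ∧ ¬ ψ) ⇒ γ → H ⊢ ¬ (φ ∨ ψ) ⇒ γ
  ¬∨r  : ∀ Γ {φ ψ} → H ⊢ Γ ⇛ (¬ φ ∧ ¬ ψ) → H ⊢ Γ ⇛ ¬ (φ ∨ ψ)
  ¬¬l  : ∀ {φ γ} → H ⊢ φ ⇒ γ → H ⊢ ¬ ¬ φ ⇒ γ
  ¬¬r  : ∀ Γ {φ} → H ⊢ Γ ⇛ φ → H ⊢ Γ ⇛ ¬ ¬ φ

module Submission where

-- It splits into three facts.
--   1. (deduction) Γ ∪ {φ} ⊢ ψ implies Γ ⊢ φ ⇒² ψ, by induction on the
--      derivation: every rule of S is sound "under the prefix φ ⇒ φ ⇒ _".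
--      Rules acting on a context list Γ' just absorb the prefix into Γ'; rules
--      acting on the left of an implication need the prefix moved past their
--      antecedents and back, and rules (E) and (⇒l) duplicate the prefix,
--      which (C) contracts again.  All of this is the exchange lemma below, which lets
--      two blocks of antecedents trade places using rule (P).
--   2. Γ ⊢ φ ⇒² ψ implies Γ ⊢ φ² ⇒ ψ, by contraposition (A5) and (¬¬r).
--   3. Conversely φ ⊢ φ² by (¬⇒r), so Γ ⊢ φ² ⇒ ψ gives Γ ∪ {φ} ⊢ ψ by
--      weakening and modus ponens.

open import Defs
open import Function.Bundles using (_⇔_; mk⇔)
open import Data.List using (List; []; _∷_; _++_; [_])
open import Data.Sum using (inj₁; inj₂)
open import Relation.Binary.PropositionalEquality using (_≡_; refl; sym; cong; subst)

⇛-++ : ∀ Δ Σ Y → ((Δ ++ Σ) ⇛ Y) ≡ (Δ ⇛ (Σ ⇛ Y))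
⇛-++ []      Σ Y = refl
⇛-++ (δ ∷ Δ) Σ Y = cong (δ ⇒_) (⇛-++ Δ Σ Y)

module _ {H : Pred} where

  split : ∀ Δ Σ {Y} → H ⊢ (Δ ++ Σ) ⇛ Y → H ⊢ Δ ⇛ (Σ ⇛ Y)
  split Δ Σ {Y} = subst (H ⊢_) (⇛-++ Δ Σ Y)

  join : ∀ Δ Σ {Y} → H ⊢ Δ ⇛ (Σ ⇛ Y) → H ⊢ (Δ ++ Σ) ⇛ Y
  join Δ Σ {Y} = subst (H ⊢_) (sym (⇛-++ Δ Σ Y))

  pull : ∀ Δ A {β Y} → H ⊢ Δ ⇛ (A ⇛ (β ⇒ Y)) → H ⊢ Δ ⇛ (β ⇒ (A ⇛ Y))
  pull Δ []      d = d
  pull Δ (α ∷ A) d = P Δ (split Δ [ α ] (pull (Δ ++ [ α ]) A (join Δ [ α ] d)))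

  exchange : ∀ Δ A B {Y} → H ⊢ Δ ⇛ (A ⇛ (B ⇛ Y)) → H ⊢ Δ ⇛ (B ⇛ (A ⇛ Y))
  exchange Δ A []      d = d
  exchange Δ A (β ∷ B) d =
    split Δ [ β ] (exchange (Δ ++ [ β ]) A B (join Δ [ β ] (pull Δ A d)))

  mp : ∀ {A B} → H ⊢ A → H ⊢ A ⇒ B → H ⊢ B
  mp = E []

  contraposition : ∀ {A B} → H ⊢ (A ⇒ B) ⇒ (¬ B ⇒ ¬ A)
  contraposition = mp A5 (∧l1 A1)

  uncontrapose : ∀ {A B} → H ⊢ ¬ B ⇒ ¬ A → H ⊢ A ⇒ B
  uncontrapose d = mp d (mp A5 (∧l2 A1))

  -- φ ⇒² ψ yields φ² ⇒ ψ: contrapose the inner implication to get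
  -- ¬ψ ⇒ φ ⇒ ¬φ, double-negate, and contrapose back.
  square-left : ∀ {φ ψ} → H ⊢ φ ⇒² ψ → H ⊢ (φ ²) ⇒ ψ
  square-left {φ} {ψ} d =
    uncontrapose (¬¬r [ ¬ ψ ] (P [] (E [ φ ] d contraposition)))

  -- φ ⊢ φ²: rule (¬⇒r) reduces ¬(φ ⇒ ¬φ) to φ ∧ ¬¬φ.
  square-intro : ∀ {φ} → H ⊢ φ → H ⊢ φ ²
  square-intro d = ¬⇒r [] (∧r [] d (¬¬r [] d))

weaken : ∀ {H H′ : Pred} → (∀ {χ} → H χ → H′ χ) → ∀ {X} → H ⊢ X → H′ ⊢ X
weaken f (hyp h)      = hyp (f h)
weaken f A1           = A1
weaken f A2           = A2
weaken f A3           = A3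
weaken f A4           = A4
weaken f A5           = A5
weaken f (P Γ d)      = P Γ (weaken f d)
weaken f (C d)        = C (weaken f d)
weaken f (E Γ d e)    = E Γ (weaken f d) (weaken f e)
weaken f (⇒l Γ d e)   = ⇒l Γ (weaken f d) (weaken f e)
weaken f (⇒r d)       = ⇒r (weaken f d)
weaken f (∧l1 d)      = ∧l1 (weaken f d)
weaken f (∧l2 d)      = ∧l2 (weaken f d)
weaken f (∧r Γ d e)   = ∧r Γ (weaken f d) (weaken f e)
weaken f (∨l1 d e)    = ∨l1 (weaken f d) (weaken f e)
weaken f (∨l2 d e)    = ∨l2 (weaken f d) (weaken f e)
weaken f (∨r1 Γ d)    = ∨r1 Γ (weaken f d)
weaken f (∨r2 Γ d)    = ∨r2 Γ (weaken f d)
weaken f (¬⇒l d)      = ¬⇒l (weaken f d)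
weaken f (¬⇒r Γ d)    = ¬⇒r Γ (weaken f d)
weaken f (¬∧l d)      = ¬∧l (weaken f d)
weaken f (¬∧r Γ d)    = ¬∧r Γ (weaken f d)
weaken f (¬∨l d)      = ¬∨l (weaken f d)
weaken f (¬∨r Γ d)    = ¬∨r Γ (weaken f d)
weaken f (¬¬l d)      = ¬¬l (weaken f d)
weaken f (¬¬r Γ d)    = ¬¬r Γ (weaken f d)

-- The deduction theorem for a fixed set Γ and discharged premiss φ.
-- Throughout, φ ⇒² X is definitionally the context φφ = (φ, φ) in front of X.
module Deduction (Γ : Pred) (φ : Form) where

  φφ : List Form
  φφ = φ ∷ φ ∷ []

  inside : ∀ L {X} → Γ ⊢ φ ⇒² (L ⇛ X) → Γ ⊢ L ⇛ (φ ⇒² X)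
  inside L = exchange [] φφ L

  outside : ∀ L {X} → Γ ⊢ L ⇛ (φ ⇒² X) → Γ ⊢ φ ⇒² (L ⇛ X)
  outside L = exchange [] L φφ

  vacuous : ∀ {X} → Γ ⊢ X → Γ ⊢ φ ⇒² X
  vacuous d = ⇒r (⇒r d)

  -- A duplicated prefix, as produced by rule (E), contracts by (C) twice
  -- after being gathered in front of the context L.
  contract : ∀ L {X} → Γ ⊢ φ ⇒² (L ⇛ (φ ⇒² X)) → Γ ⊢ φ ⇒² (L ⇛ X)
  contract L d = C (C (exchange φφ L φφ d))

  left-rule : ∀ {A B Y} → (Γ ⊢ A ⇒ (φ ⇒² Y) → Γ ⊢ B ⇒ (φ ⇒² Y)) →
              Γ ⊢ φ ⇒² (A ⇒ Y) → Γ ⊢ φ ⇒² (B ⇒ Y)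
  left-rule {A} {B} rule d = outside [ B ] (rule (inside [ A ] d))

  -- Rules with a context list absorb φφ into it (for the ⇛² rule (¬⇒r)
  -- only one copy of φ, since φ ⇒² X is already (φ ∷ []) ⇛² X); left rules
  -- move the prefix past their antecedents and back; (E) and (⇒l) combine
  -- two prefixed derivations, and the duplicated prefix is contracted.
  deduction : ∀ {ψ} → Γ ,, φ ⊢ ψ → Γ ⊢ φ ⇒² ψ
  deduction (hyp (inj₁ h))    = vacuous (hyp h)
  deduction (hyp (inj₂ refl)) = ⇒r A1
  deduction A1                = vacuous A1
  deduction A2                = vacuous A2
  deduction A3                = vacuous A3
  deduction A4                = vacuous A4
  deduction A5                = vacuous A5
  deduction (P L d)           = P (φφ ++ L) (deduction d)
  deduction (C {χ} d)         =
    outside (χ ∷ χ ∷ []) (C (inside (χ ∷ χ ∷ χ ∷ []) (deduction d)))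
  deduction (E L d e)         =
    contract L (E (φφ ++ L) (deduction d) (inside [ _ ] (deduction e)))
  deduction (⇒l L d e)        =
    contract L (exchange (φφ ++ L) [ _ ] φφ
      (⇒l (φφ ++ L) (deduction d) (inside [ _ ] (deduction e))))
  deduction (⇒r d)            = outside [ _ ] (⇒r (deduction d))
  deduction (∧l1 d)           = left-rule ∧l1 (deduction d)
  deduction (∧l2 d)           = left-rule ∧l2 (deduction d)
  deduction (∧r L d e)        = ∧r (φφ ++ L) (deduction d) (deduction e)
  deduction (∨l1 d e)         =
    outside [ _ ] (∨l1 (inside [ _ ] (deduction d)) (inside [ _ ] (deduction e)))
  deduction (∨l2 {χ₁} {χ₂} d e) =
    outside (χ₁ ∨ χ₂ ∷ χ₁ ∨ χ₂ ∷ [])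
      (∨l2 (inside (χ₁ ∷ χ₁ ∷ []) (deduction d)) (inside (χ₂ ∷ χ₂ ∷ []) (deduction e)))
  deduction (∨r1 L d)         = ∨r1 (φφ ++ L) (deduction d)
  deduction (∨r2 L d)         = ∨r2 (φφ ++ L) (deduction d)
  deduction (¬⇒l d)           = left-rule ¬⇒l (deduction d)
  deduction (¬⇒r L d)         = ¬⇒r (φ ∷ L) (deduction d)
  deduction (¬∧l d)           = left-rule ¬∧l (deduction d)
  deduction (¬∧r L d)         = ¬∧r (φφ ++ L) (deduction d)
  deduction (¬∨l d)           = left-rule ¬∨l (deduction d)
  deduction (¬∨r L d)         = ¬∨r (φφ ++ L) (deduction d)
  deduction (¬¬l d)           = left-rule ¬¬l (deduction d)
  deduction (¬¬r L d)         = ¬¬r (φφ ++ L) (deduction d)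

theorem4p4 : (Γ : Pred) (φ ψ : Form) → (Γ ,, φ ⊢ ψ) ⇔ (Γ ⊢ (φ ²) ⇒ ψ)
theorem4p4 Γ φ ψ = mk⇔ discharge undischarge
  where
    discharge : Γ ,, φ ⊢ ψ → Γ ⊢ (φ ²) ⇒ ψ
    discharge d = square-left (Deduction.deduction Γ φ d)

    φ²-holds : Γ ,, φ ⊢ φ ²
    φ²-holds = square-intro (hyp (inj₂ refl))

    undischarge : Γ ⊢ (φ ²) ⇒ ψ → Γ ,, φ ⊢ ψ
    undischarge d = mp φ²-holds (weaken inj₁ d)
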